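{- If $M$ is a finite monoid that is not a group, then $\mathrm{Member}(M)$ is not in $\mathrm{UDynProp}$.
   Context: Dynamic descriptive complexity over alphabet $M$: a word $w_1\cdots w_n$ ($w_i\in M$, $\epsilon$ identified with the identity) is encoded on domain $\{1,\dots,n\}$ with unary relations $W_m$ ($m\in M$) and the order $\le$; changes $\mathrm{set}_m(i)$ set position $i$ to $m$. A dynamic program has, for each auxiliary relation $R$ and each $m$, an update formula $\varphi^R_m(\bar x;y)$; after $\mathrm{set}_m(i)$, new $R=\{\bar a:\varphi^R_m(\bar a;i)$ holds in (changed word, old auxiliary relations)$\}$; initially the word is all identity and auxiliary relations are first-order definable. $\mathrm{Member}(M)$: maintain for each $x\in M$ a $0$-ary relation true iff $w_1\cdots w_n=x$ in $M$. $\mathrm{UDynProp}$: auxiliary relations of arity $\le 1$ and quantifier-free update formulas. -}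

module Defs where

open import Data.Nat using (ℕ; zero; suc)
open import Data.Fin using (Fin; zero; suc; _≟_; _≤?_)
open import Data.Bool using (Bool; true; false; not; _∧_; _∨_)
open import Data.List using (List; []; _∷_)
open import Data.Product using (Σ; _×_; _,_; ∃)
open import Relation.Nullary.Decidable using (⌊_⌋)
open import Relation.Binary.PropositionalEquality using (_≡_)
open import Algebra.Structures using (IsMonoid)
open import Function.Bundles using (_⇔_)

-- Finite monoids: carrier Fin size (every finite monoid is isomorphic
-- to one of this form), with propositional equality.

record FiniteMonoid : Set where
  field
    size     : ℕ
    _∙_      : Fin size → Fin size → Fin size
    e        : Fin size
    isMonoid : IsMonoid _≡_ _∙_ e

IsGroupM : FiniteMonoid → Set
IsGroupM M = ∀ x → ∃ λ y → (x ∙ y ≡ e) × (y ∙ x ≡ e)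
  where open FiniteMonoid M

-- Words of length n over M: positions Fin n (= {1..n}), letters Fin k.

prod : (M : FiniteMonoid) → ∀ {n} → (Fin n → Fin (FiniteMonoid.size M)) → Fin (FiniteMonoid.size M)
prod M {zero}  w = FiniteMonoid.e M
prod M {suc n} w = FiniteMonoid._∙_ M (w zero) (prod M (λ i → w (suc i)))

-- Syntax.  Variables are de Bruijn indices Fin v.
-- k = alphabet size (input relations W_m, m : Fin k), plus ≤ and =.

data FO (k : ℕ) : ℕ → Set where
  tt ff  : ∀ {v} → FO k v
  W      : ∀ {v} → Fin k → Fin v → FO k v
  leq    : ∀ {v} → Fin v → Fin v → FO k v
  eq     : ∀ {v} → Fin v → Fin v → FO k v
  neg    : ∀ {v} → FO k v → FO k v
  and or : ∀ {v} → FO k v → FO k v → FO k v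
  all ex : ∀ {v} → FO k (suc v) → FO k v

data QF (k a b v : ℕ) : Set where
  tt ff  : QF k a b v
  W      : Fin k → Fin v → QF k a b v
  leq    : Fin v → Fin v → QF k a b v
  eq     : Fin v → Fin v → QF k a b v
  Aux0   : Fin a → QF k a b v
  Aux1   : Fin b → Fin v → QF k a b v
  neg    : QF k a b v → QF k a b v
  and or : QF k a b v → QF k a b v → QF k a b v

anyFin : ∀ {n} → (Fin n → Bool) → Bool
anyFin {zero}  f = false
anyFin {suc n} f = f zero ∨ anyFin (λ i → f (suc i))

allFin : ∀ {n} → (Fin n → Bool) → Bool
allFin {zero}  f = true
allFin {suc n} f = f zero ∧ allFin (λ i → f (suc i))

extend : ∀ {n v} → Fin n → (Fin v → Fin n) → Fin (suc v) → Fin n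
extend d ρ zero    = d
extend d ρ (suc i) = ρ i

evalFO : ∀ {k n v} → (Fin n → Fin k) → (Fin v → Fin n) → FO k v → Bool
evalFO w ρ tt        = true
evalFO w ρ ff        = false
evalFO w ρ (W m t)   = ⌊ w (ρ t) ≟ m ⌋
evalFO w ρ (leq s t) = ⌊ ρ s ≤? ρ t ⌋
evalFO w ρ (eq s t)  = ⌊ ρ s ≟ ρ t ⌋
evalFO w ρ (neg φ)   = not (evalFO w ρ φ)
evalFO w ρ (and φ ψ) = evalFO w ρ φ ∧ evalFO w ρ ψ
evalFO w ρ (or φ ψ)  = evalFO w ρ φ ∨ evalFO w ρ ψ
evalFO w ρ (all φ)   = allFin (λ d → evalFO w (extend d ρ) φ)
evalFO w ρ (ex φ)    = anyFin (λ d → evalFO w (extend d ρ) φ)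

record State (k a b n : ℕ) : Set where
  constructor state
  field
    word : Fin n → Fin k
    aux0 : Fin a → Bool
    aux1 : Fin b → Fin n → Bool

evalQF : ∀ {k a b n v} → State k a b n → (Fin v → Fin n) → QF k a b v → Bool
evalQF S ρ tt         = true
evalQF S ρ ff         = false
evalQF S ρ (W m t)    = ⌊ State.word S (ρ t) ≟ m ⌋
evalQF S ρ (leq s t)  = ⌊ ρ s ≤? ρ t ⌋
evalQF S ρ (eq s t)   = ⌊ ρ s ≟ ρ t ⌋
evalQF S ρ (Aux0 r)   = State.aux0 S r
evalQF S ρ (Aux1 r t) = State.aux1 S r (ρ t)
evalQF S ρ (neg φ)    = not (evalQF S ρ φ)
evalQF S ρ (and φ ψ)  = evalQF S ρ φ ∧ evalQF S ρ ψ
evalQF S ρ (or φ ψ)   = evalQF S ρ φ ∨ evalQF S ρ ψ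

-- Variable conventions: for 0-ary updates φ(;y), y = zero : Fin 1;
-- for unary updates φ(x;y), x = zero, y = suc zero : Fin 2;
-- unary initialization formulas have free variable x = zero : Fin 1.

record UProgram (k : ℕ) : Set where
  field
    a b   : ℕ
    upd0  : Fin a → Fin k → QF k a b 1
    upd1  : Fin b → Fin k → QF k a b 2
    init0 : Fin a → FO k 0
    init1 : Fin b → FO k 1
    query : Fin k → Fin a   -- the 0-ary relation maintained for x ∈ M

module _ {k : ℕ} (P : UProgram k) where
  open UProgram P

  setWord : ∀ {n} → (Fin n → Fin k) → Fin k → Fin n → Fin n → Fin k
  setWord w m i j with ⌊ j ≟ i ⌋
  ... | true  = m
  ... | false = w j

  step : ∀ {n} → State k a b n → Fin k × Fin n → State k a b n
  step S (m , i) = state w′ r0 r1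
    where
      w′ = setWord (State.word S) m i
      S′ = state w′ (State.aux0 S) (State.aux1 S)
      r0 : Fin a → Bool
      r0 r = evalQF S′ (λ _ → i) (upd0 r m)
      r1 : Fin b → _ → Bool
      r1 r d = evalQF S′ (extend d (λ _ → i)) (upd1 r m)

  run : ∀ {n} → State k a b n → List (Fin k × Fin n) → State k a b n
  run S []       = S
  run S (c ∷ cs) = run (step S c) cs

  initState : (e : Fin k) → (n : ℕ) → State k a b n
  initState e n = state w0 (λ r → evalFO w0 (λ ()) (init0 r))
                           (λ r d → evalFO w0 (λ _ → d) (init1 r))
    where
      w0 : Fin n → Fin k
      w0 _ = e

Maintains : (M : FiniteMonoid) → UProgram (FiniteMonoid.size M) → Set
Maintains M P = ∀ (n : ℕ) (cs : List (Fin (FiniteMonoid.size M) × Fin n))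
                  (x : Fin (FiniteMonoid.size M)) →
  let S = run P (initState P (FiniteMonoid.e M) n) cs in
  (State.aux0 S (UProgram.query P x) ≡ true) ⇔ (prod M (State.word S) ≡ x)

MemberInUDynProp : FiniteMonoid → Set
MemberInUDynProp M = Σ (UProgram (FiniteMonoid.size M)) (Maintains M)

-- Fix a non-invertible z ∈ M. A quantifier-free update after a change at position i sees, at a
-- position d, only the 0-ary relations (flags), the letters and unary-relation values (colours)
-- of i and d, and their order. Write z from left to right into positions that all carry e and the
-- same colour (by pigeonhole, the initial structure has long such increasing sequences). Then the
-- flags, and the colour of each written position, are obtained by iterating fixed maps on a finite
-- set of profiles, so they are eventually periodic with period K! (K the number of profiles).
-- Hence writing z on g(0), …, g(2K + K!) or on all of these but the block of K! after g(K) leaves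
-- the same flags, and the same colours on the positions written both times. Resetting those
-- positions to e keeps the flags equal, but the first word is then e⋯e, of product e, while the
-- second still contains z, so its product is a positive power of z, which is not e.

module Submission where

open import Defs
open import Algebra.Structures using (IsMonoid)
open import Data.Bool using (Bool; true; false; not; _∧_; _∨_)
open import Data.Empty using (⊥-elim)
open import Data.Fin using (Fin; zero; suc; toℕ; _<_; _≟_; _≤?_; _↑ˡ_; _↑ʳ_; cast; combine; fromℕ<)
open import Data.Fin.Properties
  using (<-cmp; <⇒≢; toℕ-↑ˡ; toℕ-↑ʳ; toℕ-cast; toℕ<n; pigeonhole; combine-injective; ¬∀⟶∃¬; any?)
  renaming (suc-injective to fin-suc-injective)
open import Data.List using (List; []; _∷_; _++_)
import Data.List as List
open import Data.Nat as ℕ using (ℕ; zero; suc; _+_; _*_; _^_; _!; z≤n; s≤s)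
open import Data.Nat.Divisibility using (divides; m∣m*n; ∣-trans; m≤n⇒m!∣n!)
open import Data.Nat.GeneralisedArithmetic using (iterate)
open import Data.Nat.Properties
  using (n<1+n; ≤-pred; ≤-trans; <⇒≤; <⇒≱; m≤n+m; m≤m+n; +-suc; +-comm; +-monoʳ-<; +-cancelˡ-≤;
         m+n≮m; suc-injective; ≤-refl; +-monoˡ-≤; +-assoc; n≤1+n; m≤n⇒∃[o]m+o≡n; 1≤n!)
open import Data.Nat.Tactic.RingSolver using (solve-∀)
open import Data.Product using (Σ; ∃; ∃₂; _×_; _,_; proj₁; proj₂)
open import Data.Sum as Sum using (_⊎_; inj₁; inj₂)
open import Data.Vec using (Vec; []; _∷_; lookup; tabulate)
open import Data.Vec.Properties using (lookup∘tabulate; tabulate-cong; tabulate∘lookup)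
open import Function using (_∘_; id)
open import Function.Bundles using (Equivalence)
open import Function.Definitions using (Injective)
open import Relation.Binary.Definitions using (Monotonic₁; tri<; tri≈; tri>)
open import Relation.Binary.PropositionalEquality
open import Relation.Nullary using (¬_; Dec; yes; no)
open import Relation.Nullary.Decidable using (⌊_⌋; isYes≗does; dec-true; dec-false; _×-dec_)

private
  variable
    m n T : ℕ

⌊⌋-yes : ∀ {A : Set} (a? : Dec A) → A → ⌊ a? ⌋ ≡ true
⌊⌋-yes a? a = trans (isYes≗does a?) (dec-true a? a)

⌊⌋-no : ∀ {A : Set} (a? : Dec A) → ¬ A → ⌊ a? ⌋ ≡ false
⌊⌋-no a? ¬a = trans (isYes≗does a?) (dec-false a? ¬a)

StrictlyIncreasing : (Fin m → Fin n) → Set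
StrictlyIncreasing = Monotonic₁ _<_ _<_

module _ {ι : Fin m → Fin n} (ι-increasing : StrictlyIncreasing ι) where

  increasing-≤? : ∀ i j → ⌊ ι i ≤? ι j ⌋ ≡ ⌊ i ≤? j ⌋
  increasing-≤? i j with <-cmp i j
  ... | tri< i<j _ _ =
    trans (⌊⌋-yes (ι i ≤? ι j) (<⇒≤ (ι-increasing i<j))) (sym (⌊⌋-yes (i ≤? j) (<⇒≤ i<j)))
  ... | tri≈ _ refl _ = trans (⌊⌋-yes (ι i ≤? ι i) ≤-refl) (sym (⌊⌋-yes (i ≤? i) ≤-refl))
  ... | tri> _ _ j<i =
    trans (⌊⌋-no (ι i ≤? ι j) (<⇒≱ (ι-increasing j<i))) (sym (⌊⌋-no (i ≤? j) (<⇒≱ j<i)))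

  increasing-injective : Injective _≡_ _≡_ ι
  increasing-injective {i} {j} ιi≡ιj with <-cmp i j
  ... | tri< i<j _ _ = ⊥-elim (<⇒≢ (ι-increasing i<j) ιi≡ιj)
  ... | tri≈ _ i≡j _ = i≡j
  ... | tri> _ _ j<i = ⊥-elim (<⇒≢ (ι-increasing j<i) (sym ιi≡ιj))

  increasing-≟ : ∀ i j → ⌊ ι i ≟ ι j ⌋ ≡ ⌊ i ≟ j ⌋
  increasing-≟ i j with i ≟ j
  ... | yes refl = ⌊⌋-yes (ι i ≟ ι i) refl
  ... | no i≢j = ⌊⌋-no (ι i ≟ ι j) (i≢j ∘ increasing-injective)

suc-increasing : StrictlyIncreasing {n} {suc n} suc
suc-increasing = s≤s

cast-increasing : .(m≡n : m ≡ n) → StrictlyIncreasing (cast m≡n)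
cast-increasing m≡n {i} {j} = subst₂ ℕ._<_ (sym (toℕ-cast m≡n i)) (sym (toℕ-cast m≡n j))

increasing-tail : {g : Fin (suc m) → Fin n} → StrictlyIncreasing g → StrictlyIncreasing (g ∘ suc)
increasing-tail g-increasing i<j = g-increasing (s≤s i<j)

singleton-increasing : (x : Fin n) → StrictlyIncreasing {1} (λ _ → x)
singleton-increasing x {zero} {zero} ()

pair-increasing : {p q : Fin n} → p < q → StrictlyIncreasing (lookup (p ∷ q ∷ []))
pair-increasing p<q {zero} {suc zero} _ = p<q
pair-increasing p<q {zero} {zero} ()
pair-increasing p<q {suc zero} {zero} ()
pair-increasing p<q {suc zero} {suc zero} (s≤s ())

skip : ∀ L {p R} → Fin (L + R) → Fin (L + (p + R))
skip zero    {p} j       = p ↑ʳ j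
skip (suc L)     zero    = zero
skip (suc L)     (suc j) = suc (skip L j)

skip-increasing : ∀ L {p R} → StrictlyIncreasing (skip L {p} {R})
skip-increasing zero {p} {x = i} {j} i<j =
  subst₂ ℕ._<_ (sym (toℕ-↑ʳ p i)) (sym (toℕ-↑ʳ p j)) (+-monoʳ-< p i<j)
skip-increasing (suc L) {x = zero}  {suc j} _         = s≤s z≤n
skip-increasing (suc L) {x = suc i} {suc j} (s≤s i<j) = s≤s (skip-increasing L i<j)

skip-toℕ : ∀ L {p R} (j : Fin (L + R)) →
  (toℕ j ℕ.< L × toℕ (skip L {p} j) ≡ toℕ j) ⊎ (L ℕ.≤ toℕ j × toℕ (skip L {p} j) ≡ p + toℕ j)
skip-toℕ zero    {p} j       = inj₂ (z≤n , toℕ-↑ʳ p j)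
skip-toℕ (suc L)     zero    = inj₁ (s≤s z≤n , refl)
skip-toℕ (suc L) {p} (suc j) = Sum.map
  (λ (j<L , same) → s≤s j<L , cong suc same)
  (λ (L≤j , same) → s≤s L≤j , trans (cong suc same) (sym (+-suc p (toℕ j))))
  (skip-toℕ L j)

skip-avoids : ∀ L {p R} (j : Fin (L + R)) (x : Fin p) → skip L j ≢ L ↑ʳ (x ↑ˡ R)
skip-avoids zero {p} {R} j x same = m+n≮m p (toℕ j) (subst (ℕ._< p) toℕ-eq (toℕ<n x))
  where
    toℕ-eq : toℕ x ≡ p + toℕ j
    toℕ-eq = trans (sym (toℕ-↑ˡ x R)) (trans (cong toℕ (sym same)) (toℕ-↑ʳ p j))
skip-avoids (suc L) zero    x ()
skip-avoids (suc L) (suc j) x same = skip-avoids L j x (fin-suc-injective same)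

toℕ-remainder : (j : Fin T) → ∃ λ r → toℕ j + suc r ≡ T
toℕ-remainder j with m≤n⇒∃[o]m+o≡n (toℕ<n j)
... | r , j+1+r≡T = r , trans (+-suc (toℕ j) r) j+1+r≡T

-- Monochromatic increasing subsequences

Monochromatic : ∀ {C : Set} (m : ℕ) → (Fin n → C) → C → Set
Monochromatic {n} m χ c = Σ (Fin m → Fin n) λ g → StrictlyIncreasing g × ∀ j → χ (g j) ≡ c

module _ {C : Set} {c : C} where

  monochromatic-reindex : {χ : Fin n → C} {ι : Fin m → Fin n} → StrictlyIncreasing ι →
    Monochromatic T (χ ∘ ι) c → Monochromatic T χ c
  monochromatic-reindex {ι = ι} ι-increasing (g , g-increasing , g-colour) =
    ι ∘ g , ι-increasing ∘ g-increasing , g-colour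

  monochromatic-cons : (χ : Fin (suc n) → C) → χ zero ≡ c →
    Monochromatic T (χ ∘ suc) c → Monochromatic (suc T) χ c
  monochromatic-cons {n} {T} χ χ₀ (g , g-increasing , g-colour) = g′ , g′-increasing , g′-colour
    where
      g′ : Fin (suc T) → Fin (suc n)
      g′ zero    = zero
      g′ (suc j) = suc (g j)
      g′-increasing : StrictlyIncreasing g′
      g′-increasing {zero}  {suc j} _         = s≤s z≤n
      g′-increasing {suc i} {suc j} (s≤s i<j) = s≤s (g-increasing i<j)
      g′-colour : ∀ j → χ (g′ j) ≡ c
      g′-colour zero    = χ₀
      g′-colour (suc j) = g-colour j

  monochromatic-singleton : ∀ {n} (χ : Fin (suc n) → C) → χ zero ≡ c → Monochromatic 1 χ c
  monochromatic-singleton {n} χ χ₀ = (λ _ → zero) , singleton-increasing (zero {n}) , λ { zero → χ₀ }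

two-colour-subsequence : ∀ N M (χ : Fin (suc (N + M)) → Bool) →
  Monochromatic (suc N) χ true ⊎ Monochromatic (suc M) χ false
two-colour-subsequence N M χ with χ zero in χ₀
two-colour-subsequence zero    M       χ | true  = inj₁ (monochromatic-singleton χ χ₀)
two-colour-subsequence (suc N) M       χ | true  =
  Sum.map (monochromatic-cons χ χ₀) (monochromatic-reindex {χ = χ} suc-increasing)
          (two-colour-subsequence N M (χ ∘ suc))
two-colour-subsequence N       zero    χ | false = inj₂ (monochromatic-singleton χ χ₀)
two-colour-subsequence N       (suc M) χ | false =
  Sum.map (monochromatic-reindex {χ = χ} (suc-increasing ∘ cast-increasing N+1+M≡N+M+1))
          (monochromatic-cons χ χ₀ ∘ monochromatic-reindex {χ = χ ∘ suc} (cast-increasing N+1+M≡N+M+1))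
          (two-colour-subsequence N M (χ ∘ suc ∘ cast N+1+M≡N+M+1))
  where
    N+1+M≡N+M+1 : suc (N + M) ≡ N + suc M
    N+1+M≡N+M+1 = sym (+-suc N M)

monochromatic-subsequence : ∀ b N → ∃ λ n → ∀ (χ : Fin (suc n) → Fin b → Bool) →
  ∃₂ λ (c : Vec Bool b) (g : Fin (suc N) → Fin (suc n)) →
    StrictlyIncreasing g × ∀ j r → χ (g j) r ≡ lookup c r
monochromatic-subsequence zero    N = N , λ χ → [] , id , id , λ j ()
monochromatic-subsequence (suc b) N =
  let n , sub = monochromatic-subsequence b N in
  n + n , λ χ →
    let x , g₁ , g₁-increasing , g₁-colour = first-bit n χ
        c , g₂ , g₂-increasing , g₂-colour = sub (λ d r → χ (g₁ d) (suc r))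
    in x ∷ c , g₁ ∘ g₂ , g₁-increasing ∘ g₂-increasing ,
       λ { j zero → g₁-colour (g₂ j) ; j (suc r) → g₂-colour j r }
  where
    first-bit : ∀ n (χ : Fin (suc (n + n)) → Fin (suc b) → Bool) →
      ∃ λ x → Monochromatic (suc n) (λ d → χ d zero) x
    first-bit n χ with two-colour-subsequence n n (λ d → χ d zero)
    ... | inj₁ ones  = true , ones
    ... | inj₂ zeros = false , zeros

-- Eventually periodic iteration

module _ {X : Set} (f : X → X) where

  iterate-+ : ∀ x i j → iterate f x (i + j) ≡ iterate f (iterate f x i) j
  iterate-+ x zero    j = refl
  iterate-+ x (suc i) j = iterate-+ (f x) i j

  iterate-cycle-* : ∀ {y d} → iterate f y d ≡ y → ∀ q → iterate f y (q * d) ≡ y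
  iterate-cycle-* {y} {d} cycle zero    = refl
  iterate-cycle-* {y} {d} cycle (suc q) = begin
    iterate f y (d + q * d)            ≡⟨ iterate-+ y d (q * d) ⟩
    iterate f (iterate f y d) (q * d)  ≡⟨ cong (λ x → iterate f x (q * d)) cycle ⟩
    iterate f y (q * d)                ≡⟨ iterate-cycle-* cycle q ⟩
    y                                  ∎
    where open ≡-Reasoning

  module _ {K : ℕ} (code : X → Fin K) (code-injective : Injective _≡_ _≡_ code) where

    iterate-returns : ∀ x → ∃₂ λ i d → i + suc d ℕ.≤ K × iterate f (iterate f x i) (suc d) ≡ iterate f x i
    iterate-returns x with pigeonhole (n<1+n K) (λ i → code (iterate f x (toℕ i)))
    ... | i , j , i<j , same-code with m≤n⇒∃[o]m+o≡n i<j
    ... | d , i+1+d≡j = toℕ i , d , subst (ℕ._≤ K) (sym i+d+1≡j) (≤-pred (toℕ<n j)) , returns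
      where
        i+d+1≡j : toℕ i + suc d ≡ toℕ j
        i+d+1≡j = trans (+-suc (toℕ i) d) i+1+d≡j
        returns : iterate f (iterate f x (toℕ i)) (suc d) ≡ iterate f x (toℕ i)
        returns = trans (sym (iterate-+ x (toℕ i) (suc d)))
                        (trans (cong (iterate f x) i+d+1≡j) (sym (code-injective same-code)))

    -- Every cycle length is at most K, hence divides K!.
    iterate-periodic : ∀ x i → K ℕ.≤ i → iterate f x (i + K !) ≡ iterate f x i
    iterate-periodic x i K≤i with iterate-returns x
    ... | s , d , s+d+1≤K , cycle with m≤n⇒∃[o]m+o≡n (≤-trans (≤-trans (m≤m+n s (suc d)) s+d+1≤K) K≤i)
    ... | t , s+t≡i = begin
      iterate f x (i + K !)                       ≡⟨ cong (λ i → iterate f x (i + K !)) (sym s+t≡i) ⟩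
      iterate f x (s + t + K !)                   ≡⟨ cong (iterate f x) (reassociate s t (K !)) ⟩
      iterate f x (s + (K ! + t))                 ≡⟨ iterate-+ x s (K ! + t) ⟩
      iterate f y (K ! + t)                       ≡⟨ iterate-+ y (K !) t ⟩
      iterate f (iterate f y (K !)) t             ≡⟨ cong (λ z → iterate f z t) y-periodic ⟩
      iterate f y t                               ≡⟨ sym (iterate-+ x s t) ⟩
      iterate f x (s + t)                         ≡⟨ cong (iterate f x) s+t≡i ⟩
      iterate f x i                               ∎
      where
        open ≡-Reasoning
        y = iterate f x s
        reassociate : ∀ s t u → s + t + u ≡ s + (u + t)
        reassociate = solve-∀
        y-periodic : iterate f y (K !) ≡ y
        y-periodic with ∣-trans (m∣m*n {suc d} (d !)) (m≤n⇒m!∣n! (≤-trans (m≤n+m (suc d) s) s+d+1≤K))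
        ... | divides q K!≡q*d = trans (cong (iterate f y) K!≡q*d) (iterate-cycle-* cycle q)

bool-code : Bool → Fin 2
bool-code false = zero
bool-code true  = suc zero

bool-code-injective : Injective _≡_ _≡_ bool-code
bool-code-injective {false} {false} _ = refl
bool-code-injective {true}  {true}  _ = refl

vec-code : Vec Bool m → Fin (2 ^ m)
vec-code []       = zero
vec-code (x ∷ xs) = combine (bool-code x) (vec-code xs)

vec-code-injective : Injective _≡_ _≡_ (vec-code {m})
vec-code-injective {x = []}     {[]}     _ = refl
vec-code-injective {x = x ∷ xs} {y ∷ ys} same with combine-injective (bool-code x) _ (bool-code y) _ same
... | x≡y , xs≡ys = cong₂ _∷_ (bool-code-injective x≡y) (vec-code-injective xs≡ys)

module _ {X : Set} (f : X → X) {E p : ℕ}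
         (periodic : ∀ x i → E ℕ.≤ i → iterate f x (i + p) ≡ iterate f x i) where

  -- Making p extra steps after the first suc E either delays the reading time r by p (if the
  -- start time t is at most E) or delays t by p (otherwise); in both cases the delayed time is ≥ E.
  skip-schedule : ∀ (μ : X → X) x (j : Fin (suc E + E)) r → toℕ j + suc r ≡ suc E + E →
    ∃ λ r′ → toℕ (skip (suc E) {p} j) + suc r′ ≡ suc E + (p + E)
           × iterate f (μ (iterate f x (toℕ (skip (suc E) {p} j)))) r′ ≡ iterate f (μ (iterate f x (toℕ j))) r
  skip-schedule μ x j r j+r+1≡T with skip-toℕ (suc E) {p} j
  ... | inj₁ (j<L , toℕ-skip) rewrite toℕ-skip = r + p , lengths , periodic _ r E≤r
    where
      open ≡-Reasoning
      lengths : toℕ j + suc (r + p) ≡ suc E + (p + E)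
      lengths = begin
        toℕ j + suc (r + p)  ≡⟨ shuffle (toℕ j) r p ⟩
        toℕ j + suc r + p    ≡⟨ cong (_+ p) j+r+1≡T ⟩
        suc E + E + p        ≡⟨ shuffle′ E p ⟩
        suc E + (p + E)      ∎
        where
          shuffle : ∀ t r p → t + suc (r + p) ≡ t + suc r + p
          shuffle = solve-∀
          shuffle′ : ∀ E p → suc E + E + p ≡ suc E + (p + E)
          shuffle′ = solve-∀
      E≤r : E ℕ.≤ r
      E≤r = +-cancelˡ-≤ E E r
              (≤-pred (subst₂ ℕ._≤_ j+r+1≡T (+-suc E r) (+-monoˡ-≤ (suc r) (≤-pred j<L))))
  ... | inj₂ (L≤j , toℕ-skip) rewrite toℕ-skip = r , lengths , cong (λ y → iterate f (μ y) r) shifted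
    where
      open ≡-Reasoning
      lengths : p + toℕ j + suc r ≡ suc E + (p + E)
      lengths = begin
        p + toℕ j + suc r    ≡⟨ +-assoc p (toℕ j) (suc r) ⟩
        p + (toℕ j + suc r)  ≡⟨ cong (p +_) j+r+1≡T ⟩
        p + (suc E + E)      ≡⟨ shuffle p E ⟩
        suc E + (p + E)      ∎
        where
          shuffle : ∀ p E → p + (suc E + E) ≡ suc E + (p + E)
          shuffle = solve-∀
      shifted : iterate f x (p + toℕ j) ≡ iterate f x (toℕ j)
      shifted = trans (cong (iterate f x) (+-comm p (toℕ j))) (periodic x (toℕ j) (≤-trans (n≤1+n E) L≤j))

tabulate≡⇒lookup : ∀ {A : Set} {f : Fin n → A} {v} → tabulate f ≡ v → ∀ i → f i ≡ lookup v i
tabulate≡⇒lookup {f = f} f≡v i = trans (sym (lookup∘tabulate f i)) (cong (λ u → lookup u i) f≡v)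

tabulate-injective : ∀ {A : Set} {f g : Fin n → A} → tabulate f ≡ tabulate g → ∀ i → f i ≡ g i
tabulate-injective {g = g} f≡g i = trans (tabulate≡⇒lookup f≡g i) (lookup∘tabulate g i)

module _ {k a b n n′ v} (S : State k a b n) (S′ : State k a b n′) (ρ : Fin v → Fin n) (ρ′ : Fin v → Fin n′)
  (aux0-≡ : ∀ r → State.aux0 S r ≡ State.aux0 S′ r)
  (aux1-≡ : ∀ r x → State.aux1 S r (ρ x) ≡ State.aux1 S′ r (ρ′ x))
  (word-≡ : ∀ x → State.word S (ρ x) ≡ State.word S′ (ρ′ x))
  (≤?-≡ : ∀ x y → ⌊ ρ x ≤? ρ y ⌋ ≡ ⌊ ρ′ x ≤? ρ′ y ⌋)
  (≟-≡ : ∀ x y → ⌊ ρ x ≟ ρ y ⌋ ≡ ⌊ ρ′ x ≟ ρ′ y ⌋) where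

  evalQF-atomic : (φ : QF k a b v) → evalQF S ρ φ ≡ evalQF S′ ρ′ φ
  evalQF-atomic tt         = refl
  evalQF-atomic ff         = refl
  evalQF-atomic (W m x)    = cong (λ w → ⌊ w ≟ m ⌋) (word-≡ x)
  evalQF-atomic (leq x y)  = ≤?-≡ x y
  evalQF-atomic (eq x y)   = ≟-≡ x y
  evalQF-atomic (Aux0 r)   = aux0-≡ r
  evalQF-atomic (Aux1 r x) = aux1-≡ r x
  evalQF-atomic (neg φ)    = cong not (evalQF-atomic φ)
  evalQF-atomic (and φ ψ)  = cong₂ _∧_ (evalQF-atomic φ) (evalQF-atomic ψ)
  evalQF-atomic (or φ ψ)   = cong₂ _∨_ (evalQF-atomic φ) (evalQF-atomic ψ)

module _ {k a b : ℕ} where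

  evalQF-embedding : ∀ {v} {S : State k a b n} {S′ : State k a b m} {ι : Fin m → Fin n} →
    StrictlyIncreasing ι →
    (∀ r → State.aux0 S r ≡ State.aux0 S′ r) →
    (∀ r x → State.aux1 S r (ι x) ≡ State.aux1 S′ r x) →
    (∀ x → State.word S (ι x) ≡ State.word S′ x) →
    {ρ : Fin v → Fin n} {ρ′ : Fin v → Fin m} → (∀ x → ρ x ≡ ι (ρ′ x)) →
    ∀ φ → evalQF S ρ φ ≡ evalQF S′ ρ′ φ
  evalQF-embedding {S = S} {S′} {ι} ι-increasing aux0-≡ aux1-≡ word-≡ {ρ} {ρ′} ρ≡ιρ′ =
    evalQF-atomic S S′ ρ ρ′ aux0-≡
      (λ r x → trans (cong (State.aux1 S r) (ρ≡ιρ′ x)) (aux1-≡ r (ρ′ x)))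
      (λ x → trans (cong (State.word S) (ρ≡ιρ′ x)) (word-≡ (ρ′ x)))
      (λ x y → trans (cong₂ (λ i j → ⌊ i ≤? j ⌋) (ρ≡ιρ′ x) (ρ≡ιρ′ y))
                     (increasing-≤? ι-increasing (ρ′ x) (ρ′ y)))
      (λ x y → trans (cong₂ (λ i j → ⌊ i ≟ j ⌋) (ρ≡ιρ′ x) (ρ≡ιρ′ y))
                     (increasing-≟ ι-increasing (ρ′ x) (ρ′ y)))

  flagsOf : State k a b n → Vec Bool a
  flagsOf S = tabulate (State.aux0 S)

  colourOf : State k a b n → Fin n → Vec Bool b
  colourOf S d = tabulate (λ r → State.aux1 S r d)

  AgreeAt : State k a b n → State k a b n → Fin n → Set
  AgreeAt S S′ d = colourOf S d ≡ colourOf S′ d × State.word S d ≡ State.word S′ d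

  evalQF-agree : ∀ {v} {S S′ : State k a b n} → flagsOf S ≡ flagsOf S′ →
    {ρ : Fin v → Fin n} → (∀ x → AgreeAt S S′ (ρ x)) → ∀ φ → evalQF S ρ φ ≡ evalQF S′ ρ φ
  evalQF-agree {S = S} {S′} flags-≡ {ρ} agree =
    evalQF-atomic S S′ ρ ρ (tabulate-injective flags-≡) (λ r x → tabulate-injective (proj₁ (agree x)) r)
      (proj₂ ∘ agree) (λ _ _ → refl) (λ _ _ → refl)

-- Runs of a program

module Dynamics {k : ℕ} (P : UProgram k) where
  open UProgram P
  open State

  setAlong : Fin k → (Fin T → Fin n) → List (Fin k × Fin n)
  setAlong x g = List.tabulate (λ j → x , g j)

  run-++ : ∀ (S : State k a b n) xs ys → run P S (xs ++ ys) ≡ run P (run P S xs) ys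
  run-++ S []       ys = refl
  run-++ S (x ∷ xs) ys = run-++ (step P S x) xs ys

  rewriteWord : State k a b n → Fin k → Fin n → State k a b n
  rewriteWord S x i = state (setWord P (word S) x i) (aux0 S) (aux1 S)

  setWord-self : ∀ (w : Fin n → Fin k) x i → setWord P w x i i ≡ x
  setWord-self w x i rewrite ⌊⌋-yes (i ≟ i) refl = refl

  setWord-other : ∀ (w : Fin n → Fin k) x {i d} → d ≢ i → setWord P w x i d ≡ w d
  setWord-other w x {i} {d} d≢i rewrite ⌊⌋-no (d ≟ i) d≢i = refl

  setWord-cong : ∀ {w w′ : Fin n → Fin k} x i d → w d ≡ w′ d → setWord P w x i d ≡ setWord P w′ x i d
  setWord-cong x i d w≡w′ with ⌊ d ≟ i ⌋
  ... | true  = refl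
  ... | false = w≡w′

  run-word-cases : ∀ (S : State k a b n) x (g : Fin T → Fin n) d →
    (∃ λ j → d ≡ g j) ⊎ word (run P S (setAlong x g)) d ≡ word S d
  run-word-cases {T = zero}  S x g d = inj₂ refl
  run-word-cases {T = suc T} S x g d with d ≟ g zero
  ... | yes d≡g₀ = inj₁ (zero , d≡g₀)
  ... | no  d≢g₀ = Sum.map (λ (j , d≡gj) → suc j , d≡gj)
                           (λ unchanged → trans unchanged (setWord-other (word S) x d≢g₀))
                           (run-word-cases (step P S (x , g zero)) x (g ∘ suc) d)

  run-word-inside : ∀ (S : State k a b n) x {g : Fin T → Fin n} → StrictlyIncreasing g →
    ∀ j → word (run P S (setAlong x g)) (g j) ≡ x
  run-word-inside S x {g} g-increasing zero
    with run-word-cases (step P S (x , g zero)) x (g ∘ suc) (g zero)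
  ... | inj₁ (j , g₀≡gj) = ⊥-elim (<⇒≢ (g-increasing (s≤s z≤n)) g₀≡gj)
  ... | inj₂ unchanged = trans unchanged (setWord-self (word S) x (g zero))
  run-word-inside S x {g} g-increasing (suc j) =
    run-word-inside (step P S (x , g zero)) x (increasing-tail g-increasing) j

  run-letters : ∀ (Q : Fin k → Set) (S : State k a b n) x {g : Fin T → Fin n} → StrictlyIncreasing g →
    (∀ d → Q (word S d)) → Q x → ∀ d → Q (word (run P S (setAlong x g)) d)
  run-letters Q S x {g} g-increasing Q-word Q-x d with run-word-cases S x g d
  ... | inj₁ (j , refl) = subst Q (sym (run-word-inside S x g-increasing j)) Q-x
  ... | inj₂ unchanged = subst Q (sym unchanged) (Q-word d)

  Agree : (Fin T → Fin n) → State k a b n → State k a b n → Set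
  Agree h S S′ = flagsOf S ≡ flagsOf S′ × (∀ j → AgreeAt S S′ (h j))

  step-agree : ∀ {h : Fin T → Fin n} {S S′} → Agree h S S′ → ∀ x i →
    Agree h (step P S (x , h i)) (step P S′ (x , h i))
  step-agree {h = h} {S} {S′} (flags-≡ , agree) x i =
    tabulate-cong (λ r → evalQF-agree flags-≡ (λ _ → rewritten-agree i) (upd0 r x)) ,
    λ j → tabulate-cong (λ r → evalQF-agree flags-≡
                                 (λ { zero → rewritten-agree j ; (suc zero) → rewritten-agree i }) (upd1 r x)) ,
          setWord-cong x (h i) (h j) (proj₂ (agree j))
    where
      rewritten-agree : ∀ j → AgreeAt (rewriteWord S x (h i)) (rewriteWord S′ x (h i)) (h j)
      rewritten-agree j = proj₁ (agree j) , setWord-cong x (h i) (h j) (proj₂ (agree j))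

  run-agree : ∀ {h : Fin T → Fin n} {S S′} → Agree h S S′ → ∀ x →
    flagsOf (run P S (setAlong x h)) ≡ flagsOf (run P S′ (setAlong x h))
  run-agree {T = zero}  (flags-≡ , _) x = flags-≡
  run-agree {T = suc T} {h = h} agreement x =
    let flags-≡′ , agree′ = step-agree agreement x zero
    in run-agree {h = h ∘ suc} (flags-≡′ , agree′ ∘ suc) x

  pointState : Vec Bool a → Fin k → Vec Bool b → State k a b 1
  pointState β x c = state (λ _ → x) (lookup β) (λ r _ → lookup c r)

  pairState : Vec Bool a → Fin k → Vec Bool b → Fin k → Vec Bool b → State k a b 2
  pairState β x₀ c₀ x₁ c₁ =
    state (lookup (x₀ ∷ x₁ ∷ [])) (lookup β) (λ r d → lookup (lookup (c₀ ∷ c₁ ∷ []) d) r)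

  -- Effect of setting a position of colour c′ to the letter x, computed on the two-point
  -- (or one-point) substructure formed by the changed position and the observed one,
  -- which has letter w and colour c and lies to the left (ˡ) or right (ʳ).
  flagsAfter : Vec Bool a → Vec Bool b → Fin k → Vec Bool a
  flagsAfter β c′ x = tabulate λ r → evalQF (pointState β x c′) (λ _ → zero) (upd0 r x)

  colourAfter : Vec Bool a → Vec Bool b → Fin k → Vec Bool b
  colourAfter β c′ x = tabulate λ r → evalQF (pointState β x c′) (λ _ → zero) (upd1 r x)

  colourAfterˡ : Vec Bool a → Fin k → Vec Bool b → Vec Bool b → Fin k → Vec Bool b
  colourAfterˡ β w c c′ x =
    tabulate λ r → evalQF (pairState β w c x c′) (extend zero (λ _ → suc zero)) (upd1 r x)

  colourAfterʳ : Vec Bool a → Fin k → Vec Bool b → Vec Bool b → Fin k → Vec Bool b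
  colourAfterʳ β w c c′ x =
    tabulate λ r → evalQF (pairState β x c′ w c) (extend (suc zero) (λ _ → zero)) (upd1 r x)

  module _ {S : State k a b n} {i : Fin n} {x : Fin k} {β c′}
           (S-flags : flagsOf S ≡ β) (i-colour : colourOf S i ≡ c′) where

    private
      aux0-≡ : ∀ r → aux0 S r ≡ lookup β r
      aux0-≡ = tabulate≡⇒lookup S-flags
      i-aux1-≡ : ∀ r → aux1 S r i ≡ lookup c′ r
      i-aux1-≡ = tabulate≡⇒lookup i-colour

    step-flags : flagsOf (step P S (x , i)) ≡ flagsAfter β c′ x
    step-flags = tabulate-cong λ r →
      evalQF-embedding (singleton-increasing i) aux0-≡ (λ r _ → i-aux1-≡ r)
        (λ _ → setWord-self (word S) x i) (λ _ → refl) (upd0 r x)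

    step-colour : colourOf (step P S (x , i)) i ≡ colourAfter β c′ x
    step-colour = tabulate-cong λ r →
      evalQF-embedding (singleton-increasing i) aux0-≡ (λ r _ → i-aux1-≡ r)
        (λ _ → setWord-self (word S) x i) (λ { zero → refl ; (suc zero) → refl }) (upd1 r x)

    step-colourˡ : ∀ {d w c} → d < i → word S d ≡ w → colourOf S d ≡ c →
      colourOf (step P S (x , i)) d ≡ colourAfterˡ β w c c′ x
    step-colourˡ {d} {c = c} d<i d-word d-colour = tabulate-cong λ r →
      evalQF-embedding (pair-increasing d<i) aux0-≡
        (λ { r zero → d-aux1-≡ r ; r (suc zero) → i-aux1-≡ r })
        (λ { zero → trans (setWord-other (word S) x (<⇒≢ d<i)) d-word ; (suc zero) → setWord-self (word S) x i })
        (λ { zero → refl ; (suc zero) → refl }) (upd1 r x)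
      where
        d-aux1-≡ : ∀ r → aux1 S r d ≡ lookup c r
        d-aux1-≡ = tabulate≡⇒lookup d-colour

    step-colourʳ : ∀ {d w c} → i < d → word S d ≡ w → colourOf S d ≡ c →
      colourOf (step P S (x , i)) d ≡ colourAfterʳ β w c c′ x
    step-colourʳ {d} {c = c} i<d d-word d-colour = tabulate-cong λ r →
      evalQF-embedding (pair-increasing i<d) aux0-≡
        (λ { r zero → i-aux1-≡ r ; r (suc zero) → d-aux1-≡ r })
        (λ { zero → setWord-self (word S) x i
           ; (suc zero) → trans (setWord-other (word S) x (<⇒≢ i<d ∘ sym)) d-word })
        (λ { zero → refl ; (suc zero) → refl }) (upd1 r x)
      where
        d-aux1-≡ : ∀ r → aux1 S r d ≡ lookup c r
        d-aux1-≡ = tabulate≡⇒lookup d-colour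

  -- Setting z, from left to right, at positions that carry e and a common colour: the flags,
  -- the colour of one position already set (marked) and the common colour of the positions
  -- still to be set (fresh) evolve by advance, or by mark when the marked position is set.
  module Insertion (z e : Fin k) where

    record Profile : Set where
      constructor profile
      field
        flags  : Vec Bool a
        marked : Vec Bool b
        fresh  : Vec Bool b

    open Profile

    advance : Profile → Profile
    advance (profile β c f) = profile (flagsAfter β f z) (colourAfterˡ β z c f z) (colourAfterʳ β e f f z)

    mark : Profile → Profile
    mark (profile β c f) = profile (flagsAfter β f z) (colourAfter β f z) (colourAfterʳ β e f f z)

    FreshAlong : State k a b n → (Fin T → Fin n) → Profile → Set
    FreshAlong S g σ = flagsOf S ≡ flags σ × (∀ j → word S (g j) ≡ e × colourOf S (g j) ≡ fresh σ)

    step-fresh : ∀ {S : State k a b n} {g : Fin (suc T) → Fin n} {σ} → StrictlyIncreasing g →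
      FreshAlong S g σ → FreshAlong (step P S (z , g zero)) (g ∘ suc) (advance σ)
    step-fresh {S = S} {g} {σ} g-increasing (σ-flags , fresh-along) =
      step-flags σ-flags g₀-colour ,
      λ j → trans (setWord-other (word S) z (<⇒≢ (g₀<g j) ∘ sym)) (proj₁ (fresh-along (suc j))) ,
            step-colourʳ σ-flags g₀-colour (g₀<g j) (proj₁ (fresh-along (suc j))) (proj₂ (fresh-along (suc j)))
      where
        g₀-colour : colourOf S (g zero) ≡ fresh σ
        g₀-colour = proj₂ (fresh-along zero)
        g₀<g : ∀ j → g zero < g (suc j)
        g₀<g j = g-increasing (s≤s z≤n)

    insert-flags : ∀ (S : State k a b n) {g : Fin T → Fin n} σ → StrictlyIncreasing g → FreshAlong S g σ →
      flagsOf (run P S (setAlong z g)) ≡ flags (iterate advance σ T)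
    insert-flags {T = zero}  S σ _ (σ-flags , _) = σ-flags
    insert-flags {T = suc T} S {g} σ g-increasing fresh =
      insert-flags (step P S (z , g zero)) (advance σ) (increasing-tail g-increasing)
        (step-fresh {σ = σ} g-increasing fresh)

    insert-marked : ∀ (S : State k a b n) {g : Fin T → Fin n} σ {p} → StrictlyIncreasing g → FreshAlong S g σ →
      word S p ≡ z → colourOf S p ≡ marked σ → (∀ j → p < g j) →
      colourOf (run P S (setAlong z g)) p ≡ marked (iterate advance σ T)
    insert-marked {T = zero}  S σ _ _ _ p-colour _ = p-colour
    insert-marked {T = suc T} S {g} σ {p} g-increasing fresh@(σ-flags , fresh-along) p-word p-colour p<g =
      insert-marked (step P S (z , g zero)) (advance σ) (increasing-tail g-increasing)
        (step-fresh {σ = σ} g-increasing fresh)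
        (trans (setWord-other (word S) z (<⇒≢ (p<g zero))) p-word)
        (step-colourˡ σ-flags (proj₂ (fresh-along zero)) (p<g zero) p-word p-colour)
        (p<g ∘ suc)

    insert-colours : ∀ (S : State k a b n) {g : Fin T → Fin n} σ → StrictlyIncreasing g → FreshAlong S g σ →
      ∀ j r → toℕ j + suc r ≡ T →
      colourOf (run P S (setAlong z g)) (g j) ≡ marked (iterate advance (mark (iterate advance σ (toℕ j))) r)
    insert-colours {T = suc T} S {g} σ g-increasing fresh@(σ-flags , fresh-along) zero r r+1≡T
      with refl ← suc-injective r+1≡T =
      insert-marked (step P S (z , g zero)) (mark σ) (increasing-tail g-increasing)
        (step-fresh {σ = σ} g-increasing fresh)
        (setWord-self (word S) z (g zero))
        (step-colour σ-flags (proj₂ (fresh-along zero)))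
        (λ j → g-increasing (s≤s z≤n))
    insert-colours {T = suc T} S {g} σ g-increasing fresh (suc j) r j+r+1≡T =
      insert-colours (step P S (z , g zero)) (advance σ) (increasing-tail g-increasing)
        (step-fresh {σ = σ} g-increasing fresh) j r (suc-injective j+r+1≡T)

    K : ℕ
    K = 2 ^ a * (2 ^ b * 2 ^ b)

    profile-code : Profile → Fin K
    profile-code (profile β c f) = combine (vec-code β) (combine (vec-code c) (vec-code f))

    profile-code-injective : Injective _≡_ _≡_ profile-code
    profile-code-injective {profile β c f} {profile β′ c′ f′} same
      with combine-injective (vec-code β) _ (vec-code β′) _ same
    ... | β≡β′ , rest with combine-injective (vec-code c) _ (vec-code c′) _ rest
    ... | c≡c′ , f≡f′
      with refl ← vec-code-injective {x = β} {β′} β≡β′ | refl ← vec-code-injective {x = c} {c′} c≡c′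
         | refl ← vec-code-injective {x = f} {f′} f≡f′ = refl

    advance-periodic : ∀ σ i → K ℕ.≤ i → iterate advance σ (i + K !) ≡ iterate advance σ i
    advance-periodic = iterate-periodic advance profile-code profile-code-injective

    insertions-agree : ∀ (S : State k a b n) {g : Fin (suc K + (K ! + K)) → Fin n} σ →
      StrictlyIncreasing g → FreshAlong S g σ →
      Agree (g ∘ skip (suc K)) (run P S (setAlong z (g ∘ skip (suc K)))) (run P S (setAlong z g))
    insertions-agree {n} S {g} σ g-increasing fresh = flags-agree , λ j → colour-agree j , word-agree j
      where
        open ≡-Reasoning
        h : Fin (suc K + K) → Fin n
        h = g ∘ skip (suc K)
        h-increasing : StrictlyIncreasing h
        h-increasing = g-increasing ∘ skip-increasing (suc K)
        h-fresh : FreshAlong S h σ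
        h-fresh = proj₁ fresh , proj₂ fresh ∘ skip (suc K)

        flags-agree : flagsOf (run P S (setAlong z h)) ≡ flagsOf (run P S (setAlong z g))
        flags-agree = begin
          flagsOf (run P S (setAlong z h))                ≡⟨ insert-flags S σ h-increasing h-fresh ⟩
          flags (iterate advance σ (suc K + K))           ≡⟨ cong flags (advance-periodic σ _ (m≤n+m K (suc K))) ⟨
          flags (iterate advance σ (suc K + K + K !))     ≡⟨ cong (flags ∘ iterate advance σ) (shuffle K (K !)) ⟩
          flags (iterate advance σ (suc K + (K ! + K)))   ≡⟨ insert-flags S σ g-increasing fresh ⟨
          flagsOf (run P S (setAlong z g))                ∎
          where
            shuffle : ∀ K p → suc K + K + p ≡ suc K + (p + K)
            shuffle = solve-∀

        colour-agree : ∀ j → colourOf (run P S (setAlong z h)) (h j) ≡ colourOf (run P S (setAlong z g)) (h j)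
        colour-agree j with toℕ-remainder j
        ... | r , j+r+1≡T with skip-schedule advance advance-periodic mark σ j r j+r+1≡T
        ... | r′ , skip-j+r′+1≡T′ , same-profile = begin
          colourOf (run P S (setAlong z h)) (h j)
            ≡⟨ insert-colours S σ h-increasing h-fresh j r j+r+1≡T ⟩
          marked (iterate advance (mark (iterate advance σ (toℕ j))) r)
            ≡⟨ cong marked same-profile ⟨
          marked (iterate advance (mark (iterate advance σ (toℕ (skip (suc K) j)))) r′)
            ≡⟨ insert-colours S σ g-increasing fresh (skip (suc K) j) r′ skip-j+r′+1≡T′ ⟨
          colourOf (run P S (setAlong z g)) (h j)
            ∎

        word-agree : ∀ j → word (run P S (setAlong z h)) (h j) ≡ word (run P S (setAlong z g)) (h j)
        word-agree j = trans (run-word-inside S z h-increasing j) (sym (run-word-inside S z g-increasing (skip (suc K) j)))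

    indistinguishable-runs : ∃ λ n → Σ (List (Fin k × Fin n)) λ cs₁ → Σ (List (Fin k × Fin n)) λ cs₂ →
      let S₁ = run P (initState P e n) cs₁ ; S₂ = run P (initState P e n) cs₂ in
      flagsOf S₁ ≡ flagsOf S₂ × (∀ d → word S₁ d ≡ e) ×
      (∀ d → word S₂ d ≡ e ⊎ word S₂ d ≡ z) × ∃ λ d → word S₂ d ≡ z
    indistinguishable-runs with monochromatic-subsequence b (K + (K ! + K))
    ... | n , monochromatic with monochromatic (λ d r → aux1 (initState P e (suc n)) r d)
    ... | c , g , g-increasing , g-colour =
      suc n , setAlong z h ++ setAlong e h , setAlong z g ++ setAlong e h , flags-≡ , word₁ , word₂ , gap , word₂-gap
      where
        S₀ : State k a b (suc n)
        S₀ = initState P e (suc n)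
        h : Fin (suc K + K) → Fin (suc n)
        h = g ∘ skip (suc K)
        h-increasing : StrictlyIncreasing h
        h-increasing = g-increasing ∘ skip-increasing (suc K)
        σ₀ : Profile
        σ₀ = profile (flagsOf S₀) c c
        fresh₀ : FreshAlong S₀ g σ₀
        fresh₀ = refl , λ j → refl , trans (tabulate-cong (g-colour j)) (tabulate∘lookup c)
        S₁ S₂ : State k a b (suc n)
        S₁ = run P S₀ (setAlong z h)
        S₂ = run P S₀ (setAlong z g)

        flags-≡ : flagsOf (run P S₀ (setAlong z h ++ setAlong e h))
                ≡ flagsOf (run P S₀ (setAlong z g ++ setAlong e h))
        flags-≡ rewrite run-++ S₀ (setAlong z h) (setAlong e h) | run-++ S₀ (setAlong z g) (setAlong e h) =
          run-agree (insertions-agree S₀ σ₀ g-increasing fresh₀) e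

        word₁ : ∀ d → word (run P S₀ (setAlong z h ++ setAlong e h)) d ≡ e
        word₁ d rewrite run-++ S₀ (setAlong z h) (setAlong e h) with run-word-cases S₀ z h d
        ... | inj₁ (j , refl) = run-word-inside S₁ e h-increasing j
        ... | inj₂ unchanged-by-z with run-word-cases S₁ e h d
        ...   | inj₁ (j , refl) = run-word-inside S₁ e h-increasing j
        ...   | inj₂ unchanged-by-e = trans unchanged-by-e unchanged-by-z

        word₂ : ∀ d → let w = word (run P S₀ (setAlong z g ++ setAlong e h)) d in w ≡ e ⊎ w ≡ z
        word₂ rewrite run-++ S₀ (setAlong z g) (setAlong e h) =
          run-letters (λ x → x ≡ e ⊎ x ≡ z) S₂ e h-increasing
            (run-letters (λ x → x ≡ e ⊎ x ≡ z) S₀ z g-increasing (λ _ → inj₁ refl) (inj₂ refl))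
            (inj₁ refl)

        gap : Fin (suc n)
        gap = g (suc K ↑ʳ (fromℕ< (1≤n! K) ↑ˡ K))

        word₂-gap : word (run P S₀ (setAlong z g ++ setAlong e h)) gap ≡ z
        word₂-gap rewrite run-++ S₀ (setAlong z g) (setAlong e h) with run-word-cases S₂ e h gap
        ... | inj₁ (j , gap≡hj) = ⊥-elim (skip-avoids (suc K) j _ (sym (increasing-injective g-increasing gap≡hj)))
        ... | inj₂ unchanged-by-e = trans unchanged-by-e (run-word-inside S₀ z g-increasing _)

-- Words over a non-invertible element

module _ (M : FiniteMonoid) where
  open FiniteMonoid M
  open IsMonoid isMonoid using (assoc; identityˡ; identityʳ)

  Invertible : Fin size → Set
  Invertible x = ∃ λ y → x ∙ y ≡ e × y ∙ x ≡ e

  non-invertible-element : ¬ IsGroupM M → ∃ λ z → ¬ Invertible z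
  non-invertible-element not-group =
    ¬∀⟶∃¬ size Invertible (λ x → any? λ y → (x ∙ y ≟ e) ×-dec (y ∙ x ≟ e)) not-group

  prod-identity : (w : Fin n → Fin size) → (∀ d → w d ≡ e) → prod M w ≡ e
  prod-identity {zero}  w w≡e = refl
  prod-identity {suc n} w w≡e
    rewrite w≡e zero | prod-identity (w ∘ suc) (w≡e ∘ suc) = identityˡ e

  module _ (z : Fin size) where

    pow : ℕ → Fin size
    pow zero    = e
    pow (suc c) = z ∙ pow c

    pow-comm : ∀ c → pow c ∙ z ≡ z ∙ pow c
    pow-comm zero    = trans (identityˡ z) (sym (identityʳ z))
    pow-comm (suc c) = trans (assoc z (pow c) z) (cong (z ∙_) (pow-comm c))

    pow-suc-invertible : ∀ c → pow (suc c) ≡ e → Invertible z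
    pow-suc-invertible c z∙pow≡e = pow c , z∙pow≡e , trans (pow-comm c) z∙pow≡e

    OverIdentityAnd : (Fin n → Fin size) → Set
    OverIdentityAnd w = ∀ d → w d ≡ e ⊎ w d ≡ z

    prod-pow : (w : Fin n → Fin size) → OverIdentityAnd w → ∃ λ c → prod M w ≡ pow c
    prod-pow {zero}  w _      = 0 , refl
    prod-pow {suc n} w over with w zero | over zero | prod-pow (w ∘ suc) (over ∘ suc)
    ... | _ | inj₁ refl | c , tail≡ = c , trans (cong (e ∙_) tail≡) (identityˡ (pow c))
    ... | _ | inj₂ refl | c , tail≡ = suc c , cong (z ∙_) tail≡

    prod-pow-suc : (w : Fin n → Fin size) → OverIdentityAnd w → ∀ p → w p ≡ z →
      ∃ λ c → prod M w ≡ pow (suc c)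
    prod-pow-suc {suc n} w over zero    w₀≡z with prod-pow (w ∘ suc) (over ∘ suc)
    ... | c , tail≡ = c , cong₂ _∙_ w₀≡z tail≡
    prod-pow-suc {suc n} w over (suc p) wp≡z with w zero | over zero | prod-pow-suc (w ∘ suc) (over ∘ suc) p wp≡z
    ... | _ | inj₁ refl | c , tail≡ = c , trans (cong (e ∙_) tail≡) (identityˡ (pow (suc c)))
    ... | _ | inj₂ refl | c , tail≡ = suc c , cong (z ∙_) tail≡

  prod-with-non-invertible≢e : ∀ {z} → ¬ Invertible z → (w : Fin n → Fin size) → OverIdentityAnd z w →
    ∀ p → w p ≡ z → prod M w ≢ e
  prod-with-non-invertible≢e {z = z} z-non-invertible w over p wp≡z prod≡e =
    let c , prod≡pow = prod-pow-suc z w over p wp≡z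
    in z-non-invertible (pow-suc-invertible z c (trans (sym prod≡pow) prod≡e))

mainTheorem10 : (M : FiniteMonoid) → ¬ IsGroupM M → ¬ MemberInUDynProp M
mainTheorem10 M not-group (P , maintains)
  with z , z-non-invertible ← non-invertible-element M not-group
  with n , cs₁ , cs₂ , flags-≡ , word₁ , word₂ , d , word₂-d
         ← Dynamics.Insertion.indistinguishable-runs P z (FiniteMonoid.e M)
  = prod-with-non-invertible≢e M z-non-invertible _ word₂ d word₂-d (Equivalence.to (maintains n cs₂ e) accepted₂)
  where
    open FiniteMonoid M using (e)
    query-e : Fin (UProgram.a P)
    query-e = UProgram.query P e
    accepted₁ : State.aux0 (run P (initState P e n) cs₁) query-e ≡ true
    accepted₁ = Equivalence.from (maintains n cs₁ e) (prod-identity M _ word₁)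
    accepted₂ : State.aux0 (run P (initState P e n) cs₂) query-e ≡ true
    accepted₂ = trans (sym (tabulate-injective flags-≡ query-e)) accepted₁
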